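{- Let $G$ be a connected claw-free graph and let $I$ and $J$ be independent sets of $G$ with $|I|=|J|$. Then $I\leftrightarrow_{\mathrm{TS}} J$ if and only if every cycle in $G[I\Delta J]$ is resolvable with respect to $I$.
   Context: Graphs are finite and simple; claw-free means no induced $K_{1,3}$. $I\Delta J=(I\setminus J)\cup(J\setminus I)$. A TS-sequence is a sequence $I_0,\ldots,I_m$ of independent sets of the same size such that each $I_{i+1}$ is obtained from $I_i$ by a move $u\to v$: $uv\in E(G)$, $I_i\setminus I_{i+1}=\{u\}$, $I_{i+1}\setminus I_i=\{v\}$. $I\leftrightarrow_{\mathrm{TS}} J$ means a TS-sequence from $I$ to $J$ exists. For a set $I$, a cycle $v_0,v_1,\ldots,v_k=v_0$ is $I$-bad if $|\{v_i,v_{i+1}\}\cap I|=1$ for all $i$ and $G[\{v_0,\ldots,v_{k-1}\}]$ is a cycle (the cycle is chordless). (Every cycle of $G[I\Delta J]$ is $I$-bad.) The $I$-bipartition of an $I$-bad cycle $C$ is $[A,B]$ with $A=V(C)\cap I$, $B=V(C)\setminus I$. An $I$-bad cycle $C$ with $I$-bipartition $[A,B]$ is resolvable with respect to $I$ if there is an independent set $I'$ with $I\leftrightarrow_{\mathrm{TS}} I'$ such that $G[I'\cup B]$ contains no cycle. -}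

module Defs where

open import Data.Nat using (ℕ; zero; suc; _+_; _<?_)
open import Data.Fin using (Fin; zero; suc; toℕ; fromℕ<)
open import Data.Fin.Subset using (Subset; _∈_; _∉_; _∪_; _─_)
open import Data.Bool using (Bool; T)
open import Data.Product using (Σ; ∃; _×_; _,_)
open import Data.Empty using (⊥)
open import Relation.Nullary using (¬_; yes; no)
open import Relation.Binary.PropositionalEquality using (_≡_; _≢_)
open import Relation.Binary.Construct.Closure.ReflexiveTransitive using (Star)
open import Function.Definitions using (Injective)

record Graph (n : ℕ) : Set where
  field
    adj     : Fin n → Fin n → Bool
    adj-sym : ∀ u v → adj u v ≡ adj v u
    adj-irr : ∀ v → adj v v ≡ Data.Bool.false

module _ {n : ℕ} (G : Graph n) where
  open Graph G

  E : Fin n → Fin n → Set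
  E u v = T (adj u v)

  Connected : Set
  Connected = ∀ u v → Star E u v

  ClawFree : Set
  ClawFree = ∀ c a b d → E c a → E c b → E c d →
             a ≢ b → a ≢ d → b ≢ d →
             ¬ E a b → ¬ E a d → ¬ E b d → ⊥

  Independent : Subset n → Set
  Independent I = ∀ u v → u ∈ I → v ∈ I → ¬ E u v

  TSMove : Subset n → Subset n → Set
  TSMove I I' = Independent I × Independent I' ×
    ∃ λ u → ∃ λ v → E u v × u ∈ I × u ∉ I' × v ∉ I × v ∈ I' ×
      (∀ w → w ≢ u → w ≢ v → (w ∈ I → w ∈ I') × (w ∈ I' → w ∈ I))

  TSReach : Subset n → Subset n → Set
  TSReach = Star TSMove

next : ∀ {k} → Fin k → Fin k
next {suc k} i with suc (toℕ i) <? suc k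
... | yes p = fromℕ< p
... | no _  = zero

module _ {n : ℕ} (G : Graph n) where

  record Cycle : Set where
    field
      len    : ℕ
      vertex : Fin (3 + len) → Fin n
      inj    : Injective _≡_ _≡_ vertex
      edges  : ∀ i → E G (vertex i) (vertex (next i))

  CycleIn : Subset n → Cycle → Set
  CycleIn S C = ∀ i → Cycle.vertex C i ∈ S

  Acyclic : Subset n → Set
  Acyclic S = ∀ (C : Cycle) → ¬ CycleIn S C

  BPart : Subset n → Cycle → Subset n → Set
  BPart I C B = ∀ v → (v ∈ B → (Σ (Fin (3 + Cycle.len C)) (λ i → Cycle.vertex C i ≡ v)) × v ∉ I)
                    × ((Σ (Fin (3 + Cycle.len C)) (λ i → Cycle.vertex C i ≡ v)) → v ∉ I → v ∈ B)

  Resolvable : Subset n → Cycle → Set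
  Resolvable I C = ∀ B → BPart I C B →
    ∃ λ I' → Independent G I' × TSReach G I I' × Acyclic (I' ∪ B)

  _Δ_ : Subset n → Subset n → Subset n
  I Δ J = (I ─ J) ∪ (J ─ I)

-- Induction on |J ∖ I|. If a vertex x of J ∖ I has at most one neighbour in I, a token of
-- I ∖ J can be brought onto x: from its unique neighbour, or, if x is free, along a walk,
-- which claw-freeness makes possible; symmetrically for I ∖ J. Otherwise every vertex of
-- I Δ J has two neighbours in I Δ J, so G[I Δ J] contains a cycle, and resolving it
-- produces a sequence of moves along which one of the previous reductions must become
-- available. Resolvability of all cycles of the symmetric difference survives each step,
-- since claw-freeness lets a cycle through the new vertex v be rerouted through the old u.
module Submission where

open import Defs
open import Data.Nat as ℕ using (ℕ; zero; suc; _+_; _<_; _≤_; s≤s)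
import Data.Nat.Properties as ℕₚ
open import Data.Fin as Fin using (Fin; zero; suc; toℕ; inject≤)
open import Data.Fin.Properties as Finₚ using (any?)
open import Data.Fin.Subset
  using (Subset; ∣_∣; _∈_; _∉_; _∪_; _─_; _-_; ⁅_⁆; _⊆_; Nonempty; inside; outside)
open import Data.Fin.Subset.Properties
  using (_∈?_; x∈p∪q⁻; x∈p∪q⁺; x∈p∧x∉q⇒x∈p─q; x∈⁅x⁆; x∈⁅y⁆⇒x≡y; x≢y⇒x∉⁅y⁆;
         p⊂q⇒∣p∣<∣q∣; p⊆q⇒∣p∣≤∣q∣; ⊆-antisym; p─⊥≡p)
open import Data.Bool using (true; T)
open import Data.Vec using (_∷_; tabulate; here; there)
open import Data.Vec.Properties using (lookup∘tabulate; []=⇒lookup; lookup⇒[]=)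
open import Data.Product using (Σ; ∃; ∃₂; _×_; _,_; proj₁; proj₂; curry; uncurry)
open import Data.Sum using (_⊎_; inj₁; inj₂)
open import Data.Empty using (⊥-elim)
open import Function using (_∘_; flip)
open import Function.Definitions using (Injective)
open import Function.Bundles using (_⇔_; mk⇔; module Equivalence)
open import Function.Construct.Identity using (⇔-id)
open import Function.Construct.Symmetry using (⇔-sym)
open import Relation.Nullary using (¬_; Dec; yes; no; ⌊_⌋; ¬?; _×-dec_)
open import Relation.Nullary.Decidable using (T?; decidable-stable)
open import Relation.Unary using (Decidable)
open import Relation.Binary.PropositionalEquality
  using (_≡_; _≢_; refl; sym; trans; subst; subst₂; cong; module ≡-Reasoning)
open import Relation.Binary.Construct.Closure.ReflexiveTransitive
  using (Star; ε; _◅_; _◅◅_; reverse)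

open Equivalence using (to; from)

x∈p─q⁻ : ∀ {n} {p q : Subset n} {x} → x ∈ p ─ q → x ∈ p × x ∉ q
x∈p─q⁻ {p = inside ∷ p} {outside ∷ q} here = here , λ ()
x∈p─q⁻ {p = _ ∷ p} {inside ∷ q} (there x∈) =
  there (proj₁ (x∈p─q⁻ x∈)) , λ { (there x∈q) → proj₂ (x∈p─q⁻ x∈) x∈q }
x∈p─q⁻ {p = _ ∷ p} {outside ∷ q} (there x∈) =
  there (proj₁ (x∈p─q⁻ x∈)) , λ { (there x∈q) → proj₂ (x∈p─q⁻ x∈) x∈q }

∣p∣≡1+∣p-x∣ : ∀ {n} {p : Subset n} {x} → x ∈ p → ∣ p ∣ ≡ suc ∣ p - x ∣
∣p∣≡1+∣p-x∣ {p = inside ∷ p} here = cong suc (cong ∣_∣ (sym (p─⊥≡p p)))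
∣p∣≡1+∣p-x∣ {p = inside ∷ p} (there x∈) = cong suc (∣p∣≡1+∣p-x∣ x∈)
∣p∣≡1+∣p-x∣ {p = outside ∷ p} (there x∈) = ∣p∣≡1+∣p-x∣ x∈

module _ {n : ℕ} where

  ⟦_⟧ : {P : Fin n → Set} → Decidable P → Subset n
  ⟦ P? ⟧ = tabulate (λ z → ⌊ P? z ⌋)

  ∈⟦⟧⁻ : ∀ {P : Fin n → Set} (P? : Decidable P) {z} → z ∈ ⟦ P? ⟧ → P z
  ∈⟦⟧⁻ P? {z} z∈ with P? z | trans (sym (lookup∘tabulate (λ z → ⌊ P? z ⌋) z)) ([]=⇒lookup z∈)
  ... | yes p | _ = p

  ∈⟦⟧⁺ : ∀ {P : Fin n → Set} (P? : Decidable P) {z} → P z → z ∈ ⟦ P? ⟧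
  ∈⟦⟧⁺ P? {z} p = lookup⇒[]= z _ (trans (lookup∘tabulate (λ z → ⌊ P? z ⌋) z) (holds (P? z)))
    where
    holds : (d : Dec _) → ⌊ d ⌋ ≡ true
    holds (yes _) = refl
    holds (no ¬p) = ⊥-elim (¬p p)

  _[_↦_] : Subset n → Fin n → Fin n → Subset n
  I [ a ↦ b ] = (I - a) ∪ ⁅ b ⁆

  ∈[↦]⁻ : ∀ {I a b z} → z ∈ I [ a ↦ b ] → z ≡ b ⊎ (z ∈ I × z ≢ a)
  ∈[↦]⁻ {I} {a} {b} z∈ with x∈p∪q⁻ (I - a) ⁅ b ⁆ z∈
  ... | inj₁ z∈I-a = inj₂ (proj₁ (x∈p─q⁻ z∈I-a) , λ { refl → proj₂ (x∈p─q⁻ z∈I-a) (x∈⁅x⁆ a) })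
  ... | inj₂ z∈⁅b⁆ = inj₁ (x∈⁅y⁆⇒x≡y b z∈⁅b⁆)

  ∈[↦]-new : ∀ {I a b} → b ∈ I [ a ↦ b ]
  ∈[↦]-new {b = b} = x∈p∪q⁺ (inj₂ (x∈⁅x⁆ b))

  ∈[↦]-kept : ∀ {I a b z} → z ∈ I → z ≢ a → z ∈ I [ a ↦ b ]
  ∈[↦]-kept z∈ z≢a = x∈p∪q⁺ (inj₁ (x∈p∧x∉q⇒x∈p─q z∈ (x≢y⇒x∉⁅y⁆ z≢a)))

  ∈[↦]-old : ∀ {I a b z} → z ∈ I [ a ↦ b ] → z ≢ b → z ∈ I
  ∈[↦]-old z∈ z≢b with ∈[↦]⁻ z∈
  ... | inj₁ z≡b = ⊥-elim (z≢b z≡b)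
  ... | inj₂ (z∈I , _) = z∈I

  ∉[↦]-vacated : ∀ {I a b} → a ≢ b → a ∉ I [ a ↦ b ]
  ∉[↦]-vacated a≢b a∈ with ∈[↦]⁻ a∈
  ... | inj₁ a≡b = a≢b a≡b
  ... | inj₂ (_ , a≢a) = a≢a refl

  ∉[↦]-other : ∀ {I a b z} → z ∉ I → z ≢ b → z ∉ I [ a ↦ b ]
  ∉[↦]-other z∉ z≢b z∈ = z∉ (∈[↦]-old z∈ z≢b)

  [↦]-agrees : ∀ {I a b z} → z ≢ a → z ≢ b → z ∈ I [ a ↦ b ] ⇔ z ∈ I
  [↦]-agrees z≢a z≢b = mk⇔ (λ z∈ → ∈[↦]-old z∈ z≢b) (λ z∈ → ∈[↦]-kept z∈ z≢a)

  ∣[↦]∣ : ∀ {I a b} → a ∈ I → b ∉ I → ∣ I [ a ↦ b ] ∣ ≡ ∣ I ∣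
  ∣[↦]∣ {I} {a} {b} a∈ b∉ = begin
    ∣ I [ a ↦ b ] ∣          ≡⟨ ∣p∣≡1+∣p-x∣ (∈[↦]-new {I = I} {a = a}) ⟩
    suc ∣ I [ a ↦ b ] - b ∣  ≡⟨ cong (suc ∘ ∣_∣) (⊆-antisym ⊆-I-a I-a-⊆) ⟩
    suc ∣ I - a ∣            ≡⟨ sym (∣p∣≡1+∣p-x∣ a∈) ⟩
    ∣ I ∣                    ∎
    where
    open ≡-Reasoning
    ⊆-I-a : I [ a ↦ b ] - b ⊆ I - a
    ⊆-I-a z∈ with x∈p─q⁻ z∈
    ... | z∈' , z∉⁅b⁆ with ∈[↦]⁻ z∈'
    ...   | inj₁ refl = ⊥-elim (z∉⁅b⁆ (x∈⁅x⁆ b))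
    ...   | inj₂ (z∈I , z≢a) = x∈p∧x∉q⇒x∈p─q z∈I (x≢y⇒x∉⁅y⁆ z≢a)
    I-a-⊆ : I - a ⊆ I [ a ↦ b ] - b
    I-a-⊆ {z} z∈ with x∈p─q⁻ z∈
    ... | z∈I , z∉⁅a⁆ = x∈p∧x∉q⇒x∈p─q (∈[↦]-kept z∈I (λ { refl → z∉⁅a⁆ (x∈⁅x⁆ a) }))
                                      (x≢y⇒x∉⁅y⁆ λ { refl → b∉ z∈I })

  [↦]-trans : ∀ {I a q b} → q ∉ I → (I [ a ↦ q ]) [ q ↦ b ] ≡ I [ a ↦ b ]
  [↦]-trans {I} {a} {q} {b} q∉ = ⊆-antisym ⊆ʳ ⊆ˡ
    where
    ⊆ʳ : (I [ a ↦ q ]) [ q ↦ b ] ⊆ I [ a ↦ b ]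
    ⊆ʳ z∈ with ∈[↦]⁻ z∈
    ... | inj₁ refl = ∈[↦]-new
    ... | inj₂ (z∈' , z≢q) with ∈[↦]⁻ z∈'
    ...   | inj₁ z≡q = ⊥-elim (z≢q z≡q)
    ...   | inj₂ (z∈I , z≢a) = ∈[↦]-kept z∈I z≢a
    ⊆ˡ : I [ a ↦ b ] ⊆ (I [ a ↦ q ]) [ q ↦ b ]
    ⊆ˡ z∈ with ∈[↦]⁻ z∈
    ... | inj₁ refl = ∈[↦]-new
    ... | inj₂ (z∈I , z≢a) = ∈[↦]-kept (∈[↦]-kept z∈I z≢a) λ { refl → q∉ z∈I }

  [↦]-shift : ∀ {I a q b} → q ∈ I → a ≢ q → a ≢ b → (I [ q ↦ b ]) [ a ↦ q ] ≡ I [ a ↦ b ]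
  [↦]-shift {I} {a} {q} {b} q∈ a≢q a≢b = ⊆-antisym ⊆ʳ ⊆ˡ
    where
    ⊆ʳ : (I [ q ↦ b ]) [ a ↦ q ] ⊆ I [ a ↦ b ]
    ⊆ʳ z∈ with ∈[↦]⁻ z∈
    ... | inj₁ refl = ∈[↦]-kept q∈ (a≢q ∘ sym)
    ... | inj₂ (z∈' , z≢a) with ∈[↦]⁻ z∈'
    ...   | inj₁ refl = ∈[↦]-new
    ...   | inj₂ (z∈I , _) = ∈[↦]-kept z∈I z≢a
    ⊆ˡ : I [ a ↦ b ] ⊆ (I [ q ↦ b ]) [ a ↦ q ]
    ⊆ˡ {z} z∈ with ∈[↦]⁻ z∈
    ... | inj₁ refl = ∈[↦]-kept ∈[↦]-new (a≢b ∘ sym)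
    ... | inj₂ (z∈I , z≢a) with z Fin.≟ q
    ...   | yes refl = ∈[↦]-new
    ...   | no z≢q = ∈[↦]-kept (∈[↦]-kept z∈I z≢q) z≢a

  [↦]─[↦] : ∀ {X Y u v} → u ∈ Y → v ∉ X → (X [ u ↦ v ]) ─ (Y [ u ↦ v ]) ≡ X ─ Y
  [↦]─[↦] {X} {Y} {u} {v} u∈Y v∉X = ⊆-antisym ⊆ʳ ⊆ˡ
    where
    ⊆ʳ : (X [ u ↦ v ]) ─ (Y [ u ↦ v ]) ⊆ X ─ Y
    ⊆ʳ z∈ with x∈p─q⁻ z∈
    ... | z∈X' , z∉Y' with ∈[↦]⁻ z∈X'
    ...   | inj₁ refl = ⊥-elim (z∉Y' (∈[↦]-new {I = Y} {a = u}))
    ...   | inj₂ (z∈X , z≢u) = x∈p∧x∉q⇒x∈p─q z∈X (z∉Y' ∘ flip ∈[↦]-kept z≢u)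
    ⊆ˡ : X ─ Y ⊆ (X [ u ↦ v ]) ─ (Y [ u ↦ v ])
    ⊆ˡ z∈ with x∈p─q⁻ z∈
    ... | z∈X , z∉Y = x∈p∧x∉q⇒x∈p─q (∈[↦]-kept z∈X λ { refl → z∉Y u∈Y })
                                    (∉[↦]-other z∉Y λ { refl → v∉X z∈X })

  ⊆⊎Nonempty─ : ∀ (X Y : Subset n) → X ⊆ Y ⊎ Nonempty (X ─ Y)
  ⊆⊎Nonempty─ X Y with any? (_∈? X ─ Y)
  ... | yes ne = inj₂ ne
  ... | no ¬ne = inj₁ X⊆Y
    where
    X⊆Y : X ⊆ Y
    X⊆Y {z} z∈X with z ∈? Y
    ... | yes z∈Y = z∈Y
    ... | no z∉Y = ⊥-elim (¬ne (z , x∈p∧x∉q⇒x∈p─q z∈X z∉Y))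

  ∣≡∣⇒Nonempty─ : ∀ {X Y : Subset n} → ∣ X ∣ ≡ ∣ Y ∣ → Nonempty (Y ─ X) → Nonempty (X ─ Y)
  ∣≡∣⇒Nonempty─ {X} {Y} ∣X∣≡∣Y∣ (y , y∈Y─X) with ⊆⊎Nonempty─ X Y
  ... | inj₂ ne = ne
  ... | inj₁ X⊆Y = ⊥-elim (ℕₚ.<-irrefl ∣X∣≡∣Y∣ (p⊂q⇒∣p∣<∣q∣ (X⊆Y , y , x∈p─q⁻ y∈Y─X)))

  ∣≡∣∧⊆⇒≡ : ∀ {X Y : Subset n} → ∣ X ∣ ≡ ∣ Y ∣ → Y ⊆ X → X ≡ Y
  ∣≡∣∧⊆⇒≡ {X} {Y} ∣X∣≡∣Y∣ Y⊆X = ⊆-antisym X⊆Y Y⊆X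
    where
    X⊆Y : X ⊆ Y
    X⊆Y with ⊆⊎Nonempty─ X Y
    ... | inj₁ X⊆Y = X⊆Y
    ... | inj₂ (x , x∈X─Y) =
      ⊥-elim (ℕₚ.<-irrefl (sym ∣X∣≡∣Y∣) (p⊂q⇒∣p∣<∣q∣ (Y⊆X , x , x∈p─q⁻ x∈X─Y)))

module _ {n : ℕ} (G : Graph n) where
  open Graph G using (adj; adj-sym; adj-irr)

  E-sym : ∀ {u v} → E G u v → E G v u
  E-sym {u} {v} = subst T (adj-sym u v)

  E-irr : ∀ {v} → ¬ E G v v
  E-irr {v} = subst T (adj-irr v)

  E? : ∀ u v → Dec (E G u v)
  E? u v = T? (adj u v)

  E⇒≢ : ∀ {u v} → E G u v → u ≢ v
  E⇒≢ e refl = E-irr e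

  ∈Δ⁻ : ∀ {I J x} → x ∈ _Δ_ G I J → (x ∈ I × x ∉ J) ⊎ (x ∈ J × x ∉ I)
  ∈Δ⁻ {I} {J} x∈ with x∈p∪q⁻ (I ─ J) (J ─ I) x∈
  ... | inj₁ x∈I─J = inj₁ (x∈p─q⁻ x∈I─J)
  ... | inj₂ x∈J─I = inj₂ (x∈p─q⁻ x∈J─I)

  ∈Δ⁺ˡ : ∀ {I J x} → x ∈ I → x ∉ J → x ∈ _Δ_ G I J
  ∈Δ⁺ˡ x∈I x∉J = x∈p∪q⁺ (inj₁ (x∈p∧x∉q⇒x∈p─q x∈I x∉J))

  ∈Δ⁺ʳ : ∀ {I J x} → x ∈ J → x ∉ I → x ∈ _Δ_ G I J
  ∈Δ⁺ʳ x∈J x∉I = x∈p∪q⁺ (inj₂ (x∈p∧x∉q⇒x∈p─q x∈J x∉I))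

  ∈Δ∧∈⇒∉ : ∀ {I J x} → x ∈ _Δ_ G I J → x ∈ I → x ∉ J
  ∈Δ∧∈⇒∉ x∈Δ x∈I x∈J with ∈Δ⁻ x∈Δ
  ... | inj₁ (_ , x∉J) = x∉J x∈J
  ... | inj₂ (_ , x∉I) = x∉I x∈I

  ∈Δ∧∉⇒∈ : ∀ {I J x} → x ∈ _Δ_ G I J → x ∉ I → x ∈ J
  ∈Δ∧∉⇒∈ x∈Δ x∉I with ∈Δ⁻ x∈Δ
  ... | inj₁ (x∈I , _) = ⊥-elim (x∉I x∈I)
  ... | inj₂ (x∈J , _) = x∈J

  ∈Δ⇒≢-both : ∀ {I J x y} → x ∈ _Δ_ G I J → y ∈ I → y ∈ J → x ≢ y
  ∈Δ⇒≢-both x∈Δ y∈I y∈J refl = ∈Δ∧∈⇒∉ x∈Δ y∈I y∈J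

  ∈Δ⇒≢-neither : ∀ {I J x y} → x ∈ _Δ_ G I J → y ∉ I → y ∉ J → x ≢ y
  ∈Δ⇒≢-neither x∈Δ y∉I y∉J refl = y∉J (∈Δ∧∉⇒∈ x∈Δ y∉I)

  ∈Δ-cong : ∀ {I J I' J' x} → x ∈ I ⇔ x ∈ I' → x ∈ J ⇔ x ∈ J' →
            x ∈ _Δ_ G I J → x ∈ _Δ_ G I' J'
  ∈Δ-cong I⇔I' J⇔J' x∈Δ with ∈Δ⁻ x∈Δ
  ... | inj₁ (x∈I , x∉J) = ∈Δ⁺ˡ (to I⇔I' x∈I) (x∉J ∘ from J⇔J')
  ... | inj₂ (x∈J , x∉I) = ∈Δ⁺ʳ (to J⇔J' x∈J) (x∉I ∘ from I⇔I')

  Free : Subset n → Fin n → Set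
  Free I b = b ∉ I × (∀ z → z ∈ I → ¬ E G b z)

  TwoNeighbours : Subset n → Fin n → Set
  TwoNeighbours X x = ∃₂ λ y z → y ≢ z × y ∈ X × z ∈ X × E G x y × E G x z

  twoNeighbours? : ∀ X x → Dec (TwoNeighbours X x)
  twoNeighbours? X x = any? λ y → any? λ z →
    ¬? (y Fin.≟ z) ×-dec (y ∈? X) ×-dec (z ∈? X) ×-dec E? x y ×-dec E? x z

  TwoNeighbours-mono : ∀ {X Y x} → (∀ {y} → E G x y → y ∈ X → y ∈ Y) →
                      TwoNeighbours X x → TwoNeighbours Y x
  TwoNeighbours-mono X⇒Y (y , z , y≢z , y∈ , z∈ , xy , xz) =
    y , z , y≢z , X⇒Y xy y∈ , X⇒Y xz z∈ , xy , xz

  Independent-[↦] : ∀ {I a b} → Independent G I → Free I b → Independent G (I [ a ↦ b ])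
  Independent-[↦] ind (_ , b-free) x y x∈ y∈ e with ∈[↦]⁻ x∈ | ∈[↦]⁻ y∈
  ... | inj₁ refl | inj₁ refl = E-irr e
  ... | inj₁ refl | inj₂ (y∈I , _) = b-free y y∈I e
  ... | inj₂ (x∈I , _) | inj₁ refl = b-free x x∈I (E-sym e)
  ... | inj₂ (x∈I , _) | inj₂ (y∈I , _) = ind x y x∈I y∈I e

  Free-[↦] : ∀ {I q b} → Independent G I → q ∈ I → Free I b → Free (I [ q ↦ b ]) q
  Free-[↦] {I} {q} {b} ind q∈ (b∉ , b-free) = ∉[↦]-vacated (λ { refl → b∉ q∈ }) , q-free
    where
    q-free : ∀ z → z ∈ I [ q ↦ b ] → ¬ E G q z
    q-free z z∈ e with ∈[↦]⁻ z∈
    ... | inj₁ refl = b-free q q∈ (E-sym e)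
    ... | inj₂ (z∈I , _) = ind q z q∈ z∈I e

  slide-move : ∀ {I a b} → Independent G I → a ∈ I → b ∉ I → E G a b →
               (∀ z → z ∈ I → E G b z → z ≡ a) → TSMove G I (I [ a ↦ b ])
  slide-move {I} {a} {b} ind a∈ b∉ e only-a =
    ind , ind' , a , b , e , a∈ , ∉[↦]-vacated (E⇒≢ e) , b∉ , ∈[↦]-new {I = I} {a = a} ,
    λ z z≢a z≢b → from ([↦]-agrees {I = I} z≢a z≢b) , to ([↦]-agrees {I = I} z≢a z≢b)
    where
    ind' : Independent G (I [ a ↦ b ])
    ind' x y x∈ y∈ e' with ∈[↦]⁻ x∈ | ∈[↦]⁻ y∈
    ... | inj₁ refl | inj₁ refl = E-irr e'
    ... | inj₁ refl | inj₂ (y∈I , y≢a) = y≢a (only-a y y∈I e')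
    ... | inj₂ (x∈I , x≢a) | inj₁ refl = x≢a (only-a x x∈I (E-sym e'))
    ... | inj₂ (x∈I , _) | inj₂ (y∈I , _) = ind x y x∈I y∈I e'

  TSMove-sym : ∀ {I I'} → TSMove G I I' → TSMove G I' I
  TSMove-sym (ind , ind' , u , v , e , u∈ , u∉' , v∉ , v∈' , rest) =
    ind' , ind , v , u , E-sym e , v∈' , v∉ , u∉' , u∈ ,
    λ w w≢v w≢u → proj₂ (rest w w≢u w≢v) , proj₁ (rest w w≢u w≢v)

  TSReach-sym : ∀ {I I'} → TSReach G I I' → TSReach G I' I
  TSReach-sym = reverse TSMove-sym

  TSMove⇒[↦] : ∀ {I I'} → TSMove G I I' →
               ∃₂ λ u v → u ∈ I × v ∉ I × E G u v × I' ≡ I [ u ↦ v ]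
  TSMove⇒[↦] {I} {I'} (_ , _ , u , v , e , u∈ , u∉' , v∉ , v∈' , rest) =
    u , v , u∈ , v∉ , e , ⊆-antisym I'⊆ ⊆I'
    where
    I'⊆ : I' ⊆ I [ u ↦ v ]
    I'⊆ {z} z∈ with z Fin.≟ v
    ... | yes refl = ∈[↦]-new {I = I} {a = u}
    ... | no z≢v = ∈[↦]-kept (proj₂ (rest z z≢u z≢v) z∈) z≢u
      where
      z≢u : z ≢ u
      z≢u refl = u∉' z∈
    ⊆I' : I [ u ↦ v ] ⊆ I'
    ⊆I' z∈ with ∈[↦]⁻ z∈
    ... | inj₁ refl = v∈'
    ... | inj₂ (z∈I , z≢u) = proj₁ (rest _ z≢u λ { refl → v∉ z∈I }) z∈I

  TSReach-size : ∀ {I I'} → TSReach G I I' → ∣ I ∣ ≡ ∣ I' ∣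
  TSReach-size ε = refl
  TSReach-size (mv ◅ r) with TSMove⇒[↦] mv
  ... | _ , _ , u∈ , v∉ , _ , refl = trans (sym (∣[↦]∣ u∈ v∉)) (TSReach-size r)

  TSReach-independent : ∀ {I I'} → Independent G I → TSReach G I I' → Independent G I'
  TSReach-independent ind ε = ind
  TSReach-independent _ (mv ◅ r) = TSReach-independent (proj₁ (proj₂ mv)) r

module _ {n : ℕ} (G : Graph n) (claw-free : ClawFree G) where

  claw-free⇒E : ∀ {c a b d} → E G c a → E G c b → E G c d → a ≢ b → a ≢ d → b ≢ d →
                ¬ E G a b → ¬ E G a d → E G b d
  claw-free⇒E {c} {a} {b} {d} ca cb cd a≢b a≢d b≢d ¬ab ¬ad with E? G b d
  ... | yes bd = bd
  ... | no ¬bd = ⊥-elim (claw-free c a b d ca cb cd a≢b a≢d b≢d ¬ab ¬ad ¬bd)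

  -- Otherwise q would be the centre of a claw on a, b and a second I-neighbour.
  slide-two : ∀ {I a q b} → Independent G I → a ∈ I → Free G I b → E G a q → E G q b →
              TSReach G I (I [ a ↦ b ])
  slide-two {I} {a} {q} {b} ind a∈ (b∉ , b-free) aq qb =
    subst (TSReach G I) ([↦]-trans q∉) (a→q ◅ q→b ◅ ε)
    where
    q∉ : q ∉ I
    q∉ q∈ = ind a q a∈ q∈ aq
    only-a : ∀ z → z ∈ I → E G q z → z ≡ a
    only-a z z∈ qz with z Fin.≟ a
    ... | yes z≡a = z≡a
    ... | no z≢a = ⊥-elim (claw-free q a z b (E-sym G aq) qz qb (z≢a ∘ sym)
                     (λ { refl → b∉ a∈ }) (λ { refl → b∉ z∈ }) (ind a z a∈ z∈)
                     (b-free a a∈ ∘ E-sym G) (b-free z z∈ ∘ E-sym G))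
    a→q : TSMove G I (I [ a ↦ q ])
    a→q = slide-move G ind a∈ q∉ aq only-a
    only-q : ∀ z → z ∈ I [ a ↦ q ] → E G b z → z ≡ q
    only-q z z∈ bz with ∈[↦]⁻ z∈
    ... | inj₁ z≡q = z≡q
    ... | inj₂ (z∈I , _) = ⊥-elim (b-free z z∈I bz)
    q→b : TSMove G (I [ a ↦ q ]) ((I [ a ↦ q ]) [ q ↦ b ])
    q→b = slide-move G (proj₁ (proj₂ a→q)) (∈[↦]-new {I = I} {a = a})
            (∉[↦]-other b∉ (E⇒≢ G qb ∘ sym)) qb only-q

  -- Along a walk a q r … b: if r carries a token, it is slid to b first; otherwise a steps
  -- onto q, or a second I-neighbour y of q is adjacent to r (no claw at q) and is slid first.
  mutual
    slide-along : ∀ {I a b} → Independent G I → a ∈ I → Free G I b → Star (E G) a b →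
                  TSReach G I (I [ a ↦ b ])
    slide-along ind a∈ (b∉ , _) ε = ⊥-elim (b∉ a∈)
    slide-along ind a∈ b-free (aq ◅ w) = slide-via ind a∈ b-free aq w

    slide-via : ∀ {I a q b} → Independent G I → a ∈ I → Free G I b → E G a q → Star (E G) q b →
                TSReach G I (I [ a ↦ b ])
    slide-via ind a∈ (_ , b-free) aq ε = ⊥-elim (b-free _ a∈ (E-sym G aq))
    slide-via {I} {a} {q} {b} ind a∈ fb@(b∉ , b-free) aq (_◅_ {j = r} qr w) with r ∈? I
    ... | yes r∈ = via-token
      where
      via-token : TSReach G I (I [ a ↦ b ])
      via-token with r Fin.≟ a
      ... | yes refl = slide-along ind a∈ fb w
      ... | no r≢a = subst (TSReach G I) ([↦]-shift r∈ (r≢a ∘ sym) λ { refl → b∉ a∈ })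
                       (slide-along ind r∈ fb w ◅◅
                        slide-two (Independent-[↦] G ind fb) (∈[↦]-kept a∈ (r≢a ∘ sym))
                                  (Free-[↦] G ind r∈ fb) aq qr)
    ... | no r∉ with any? (λ y → (y ∈? I) ×-dec ¬? (y Fin.≟ a) ×-dec E? G q y)
    ...   | no ¬other = via-a-only
      where
      q∉ : q ∉ I
      q∉ q∈ = ind a q a∈ q∈ aq
      only-a : ∀ z → z ∈ I → E G q z → z ≡ a
      only-a z z∈ qz with z Fin.≟ a
      ... | yes z≡a = z≡a
      ... | no z≢a = ⊥-elim (¬other (z , z∈ , z≢a , qz))
      via-a-only : TSReach G I (I [ a ↦ b ])
      via-a-only with E? G q b
      ... | yes qb = slide-two ind a∈ fb aq qb
      ... | no ¬qb = subst (TSReach G I) ([↦]-trans q∉)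
                       (a→q ◅ slide-via (proj₁ (proj₂ a→q)) (∈[↦]-new {I = I} {a = a}) fb' qr w)
        where
        a→q : TSMove G I (I [ a ↦ q ])
        a→q = slide-move G ind a∈ q∉ aq only-a
        fb' : Free G (I [ a ↦ q ]) b
        fb' = ∉[↦]-other b∉ (λ { refl → b-free a a∈ (E-sym G aq) }) , b-free'
          where
          b-free' : ∀ z → z ∈ I [ a ↦ q ] → ¬ E G b z
          b-free' z z∈ bz with ∈[↦]⁻ z∈
          ... | inj₁ refl = ¬qb (E-sym G bz)
          ... | inj₂ (z∈I , _) = b-free z z∈I bz
    ...   | yes (y , y∈ , y≢a , qy) = via-other
      where
      via-other : TSReach G I (I [ a ↦ b ])
      via-other with E? G a r
      ... | yes ar = slide-via ind a∈ fb ar w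
      ... | no ¬ar = subst (TSReach G I) ([↦]-shift y∈ (y≢a ∘ sym) λ { refl → b∉ a∈ })
                       (slide-via ind y∈ fb yr w ◅◅
                        slide-two (Independent-[↦] G ind fb) (∈[↦]-kept a∈ (y≢a ∘ sym))
                                  (Free-[↦] G ind y∈ fb) aq qy)
        where
        yr : E G y r
        yr = claw-free⇒E (E-sym G aq) qy qr (y≢a ∘ sym) (λ { refl → r∉ a∈ })
               (λ { refl → r∉ y∈ }) (ind a y a∈ y∈) ¬ar

toℕ-next : ∀ {m} (i : Fin m) →
           toℕ (next i) ≡ suc (toℕ i) ⊎ (toℕ (next i) ≡ 0 × suc (toℕ i) ≡ m)
toℕ-next {suc m} i with suc (toℕ i) ℕ.<? suc m
... | yes i+1<m = inj₁ (Finₚ.toℕ-fromℕ< i+1<m)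
... | no i+1≮m = inj₂ (refl , ℕₚ.≤-antisym (Finₚ.toℕ<n i) (ℕₚ.≮⇒≥ i+1≮m))

module _ {n : ℕ} (G : Graph n) where

  record Path (S : Subset n) (k : ℕ) : Set where
    field
      vertex : Fin (suc k) → Fin n
      injective : Injective _≡_ _≡_ vertex
      within : ∀ i → vertex i ∈ S
      edge : ∀ i j → toℕ j ≡ suc (toℕ i) → E G (vertex i) (vertex j)

  module _ {S : Subset n} where

    singleton-path : ∀ {x} → x ∈ S → Path S 0
    singleton-path {x} x∈ = record
      { vertex = λ _ → x
      ; injective = λ { {zero} {zero} _ → refl }
      ; within = λ _ → x∈
      ; edge = λ { zero zero () }
      }

    extend : ∀ {k} (p : Path S k) {y} → y ∈ S → E G y (Path.vertex p zero) →
             (∀ i → Path.vertex p i ≢ y) → Path S (suc k)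
    extend p {y} y∈ y-p₀ fresh = record
      { vertex = vertex′ ; injective = injective′ ; within = within′ ; edge = edge′ }
      where
      open Path p
      vertex′ : Fin (suc (suc _)) → Fin n
      vertex′ zero = y
      vertex′ (suc i) = vertex i
      injective′ : Injective _≡_ _≡_ vertex′
      injective′ {zero} {zero} _ = refl
      injective′ {zero} {suc j} y≡ = ⊥-elim (fresh j (sym y≡))
      injective′ {suc i} {zero} ≡y = ⊥-elim (fresh i ≡y)
      injective′ {suc i} {suc j} eq = cong suc (injective eq)
      within′ : ∀ i → vertex′ i ∈ S
      within′ zero = y∈
      within′ (suc i) = within i
      edge′ : ∀ i j → toℕ j ≡ suc (toℕ i) → E G (vertex′ i) (vertex′ j)
      edge′ zero (suc j) eq =
        subst (λ j → E G y (vertex j)) (sym (Finₚ.toℕ-injective (ℕₚ.suc-injective eq))) y-p₀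
      edge′ (suc i) (suc j) eq = edge i j (ℕₚ.suc-injective eq)

    close : ∀ {k} (p : Path S (suc k)) (j : Fin k) →
            E G (Path.vertex p (suc (suc j))) (Path.vertex p zero) → Σ (Cycle G) (CycleIn G S)
    close {k} p j closing = C , λ i → within (inject≤ i len≤)
      where
      open Path p
      len≤ : 3 + toℕ j ≤ 2 + k
      len≤ = s≤s (s≤s (Finₚ.toℕ<n j))
      vertex′ : Fin (3 + toℕ j) → Fin n
      vertex′ i = vertex (inject≤ i len≤)
      edge′ : ∀ i → E G (vertex′ i) (vertex′ (next i))
      edge′ i with toℕ-next i
      ... | inj₁ next≡ = edge _ _ (trans (Finₚ.toℕ-inject≤ (next i) _)
                                    (trans next≡ (cong suc (sym (Finₚ.toℕ-inject≤ i _)))))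
      ... | inj₂ (next≡0 , i-last) =
        subst₂ (λ a b → E G (vertex a) (vertex b))
          (sym (Finₚ.toℕ-injective (trans (Finₚ.toℕ-inject≤ i _) (ℕₚ.suc-injective i-last))))
          (Finₚ.toℕ-injective (sym (trans (Finₚ.toℕ-inject≤ (next i) _) next≡0)))
          closing
      C : Cycle G
      C = record
        { len = toℕ j
        ; vertex = vertex′
        ; inj = λ eq → Finₚ.inject≤-injective len≤ len≤ _ _ (injective eq)
        ; edges = edge′
        }

    module _ (min-degree₂ : ∀ x → x ∈ S → TwoNeighbours G S x) where

      next-vertex : ∀ {k} (p : Path S (suc k)) →
                    ∃ λ y → y ∈ S × E G (Path.vertex p zero) y × y ≢ Path.vertex p (suc zero)
      next-vertex p with min-degree₂ (Path.vertex p zero) (Path.within p zero)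
      ... | y₁ , y₂ , y₁≢y₂ , y₁∈ , y₂∈ , e₁ , e₂ with y₁ Fin.≟ Path.vertex p (suc zero)
      ...   | yes refl = y₂ , y₂∈ , e₂ , λ y₂≡ → y₁≢y₂ (sym y₂≡)
      ...   | no y₁≢ = y₁ , y₁∈ , e₁ , y₁≢

      grow : ∀ r {k} → n ≤ suc k + r → Path S (suc k) → Σ (Cycle G) (CycleIn G S)
      grow zero {k} n≤ p = ⊥-elim (ℕₚ.1+n≰n (ℕₚ.≤-trans (Finₚ.injective⇒≤ (Path.injective p))
                                                  (subst (n ≤_) (ℕₚ.+-identityʳ (suc k)) n≤)))
      grow (suc r) {k} n≤ p with next-vertex p
      ... | y , y∈ , p₀y , y≢p₁ with any? (λ j → Path.vertex p j Fin.≟ y)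
      ...   | yes (zero , p₀≡y) = ⊥-elim (E⇒≢ G p₀y p₀≡y)
      ...   | yes (suc zero , p₁≡y) = ⊥-elim (y≢p₁ (sym p₁≡y))
      ...   | yes (suc (suc j) , pj≡y) =
        close p j (subst (λ t → E G t (Path.vertex p zero)) (sym pj≡y) (E-sym G p₀y))
      ...   | no fresh = grow r (subst (n ≤_) (ℕₚ.+-suc (suc k) r) n≤)
                           (extend p y∈ (E-sym G p₀y) λ i pᵢ≡y → fresh (i , pᵢ≡y))

      cycle-within : ∀ {x} → x ∈ S → Σ (Cycle G) (CycleIn G S)
      cycle-within x∈ with min-degree₂ _ x∈
      ... | y , _ , _ , y∈ , _ , xy , _ =
        grow n (ℕₚ.n≤1+n n)
          (extend (singleton-path x∈) y∈ (E-sym G xy) λ { zero refl → E-irr G xy })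

  OnCycle : Cycle G → Fin n → Set
  OnCycle C v = Σ (Fin (3 + Cycle.len C)) (λ i → Cycle.vertex C i ≡ v)

  onCycle? : ∀ C v → Dec (OnCycle C v)
  onCycle? C v = any? (λ i → Cycle.vertex C i Fin.≟ v)

  Outside : Subset n → Cycle G → Fin n → Set
  Outside I C v = OnCycle C v × v ∉ I

  outside? : ∀ I C → Decidable (Outside I C)
  outside? I C z = onCycle? C z ×-dec ¬? (z ∈? I)

  rename : Fin n → Fin n → Fin n → Fin n
  rename x y v with v Fin.≟ x
  ... | yes _ = y
  ... | no _ = v

  rename-spec : ∀ x y v → (v ≡ x × rename x y v ≡ y) ⊎ (v ≢ x × rename x y v ≡ v)
  rename-spec x y v with v Fin.≟ x
  ... | yes v≡x = inj₁ (v≡x , refl)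
  ... | no v≢x = inj₂ (v≢x , refl)

  CanReplace : Cycle G → Fin n → Fin n → Set
  CanReplace C x y = ∀ i → E G x (Cycle.vertex C i) → E G y (Cycle.vertex C i)

  canReplace? : ∀ C x y →
                CanReplace C x y ⊎ ∃ λ i → E G x (Cycle.vertex C i) × ¬ E G y (Cycle.vertex C i)
  canReplace? C x y with any? (λ i → E? G x (Cycle.vertex C i) ×-dec ¬? (E? G y (Cycle.vertex C i)))
  ... | yes witness = inj₂ witness
  ... | no ¬witness = inj₁ λ i xvᵢ → decidable-stable (E? G y _) λ ¬yvᵢ → ¬witness (i , xvᵢ , ¬yvᵢ)

  replace : (C : Cycle G) (x y : Fin n) → ¬ OnCycle C y → CanReplace C x y → Cycle G
  replace C x y y∉C can =
    record { len = len ; vertex = rename x y ∘ vertex ; inj = inj′ ; edges = edges′ }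
    where
    open Cycle C
    inj′ : Injective _≡_ _≡_ (rename x y ∘ vertex)
    inj′ {i} {j} eq with rename-spec x y (vertex i) | rename-spec x y (vertex j)
    ... | inj₁ (vᵢ≡x , _) | inj₁ (vⱼ≡x , _) = inj (trans vᵢ≡x (sym vⱼ≡x))
    ... | inj₁ (_ , rᵢ≡y) | inj₂ (_ , rⱼ≡vⱼ) =
      ⊥-elim (y∉C (j , trans (sym rⱼ≡vⱼ) (trans (sym eq) rᵢ≡y)))
    ... | inj₂ (_ , rᵢ≡vᵢ) | inj₁ (_ , rⱼ≡y) =
      ⊥-elim (y∉C (i , trans (sym rᵢ≡vᵢ) (trans eq rⱼ≡y)))
    ... | inj₂ (_ , rᵢ≡vᵢ) | inj₂ (_ , rⱼ≡vⱼ) = inj (trans (sym rᵢ≡vᵢ) (trans eq rⱼ≡vⱼ))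
    edges′ : ∀ i → E G (rename x y (vertex i)) (rename x y (vertex (next i)))
    edges′ i with rename-spec x y (vertex i) | rename-spec x y (vertex (next i))
    ... | inj₁ (refl , _) | inj₁ (vᵢ₊₁≡x , _) = ⊥-elim (E⇒≢ G (edges i) (sym vᵢ₊₁≡x))
    ... | inj₁ (refl , rᵢ≡y) | inj₂ (_ , rᵢ₊₁≡vᵢ₊₁) =
      subst₂ (E G) (sym rᵢ≡y) (sym rᵢ₊₁≡vᵢ₊₁) (can (next i) (edges i))
    ... | inj₂ (_ , rᵢ≡vᵢ) | inj₁ (refl , rᵢ₊₁≡y) =
      subst₂ (E G) (sym rᵢ≡vᵢ) (sym rᵢ₊₁≡y) (E-sym G (can i (E-sym G (edges i))))
    ... | inj₂ (_ , rᵢ≡vᵢ) | inj₂ (_ , rᵢ₊₁≡vᵢ₊₁) =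
      subst₂ (E G) (sym rᵢ≡vᵢ) (sym rᵢ₊₁≡vᵢ₊₁) (edges i)

  module _ {C : Cycle G} {x y : Fin n} {y∉C : ¬ OnCycle C y} {can : CanReplace C x y} where
    open Cycle C

    CycleIn-replace : ∀ {S} → (∀ i → vertex i ≢ x → vertex i ∈ S) → y ∈ S →
                      CycleIn G S (replace C x y y∉C can)
    CycleIn-replace kept y∈ i with rename-spec x y (vertex i)
    ... | inj₁ (_ , rᵢ≡y) = subst (_∈ _) (sym rᵢ≡y) y∈
    ... | inj₂ (vᵢ≢x , rᵢ≡vᵢ) = subst (_∈ _) (sym rᵢ≡vᵢ) (kept i vᵢ≢x)

    Outside-replace : ∀ {I I'} → x ∈ I → y ∈ I' → (∀ z → z ≢ x → z ≢ y → z ∈ I' ⇔ z ∈ I) →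
                      ∀ z → Outside I' (replace C x y y∉C can) z ⇔ Outside I C z
    Outside-replace {I} {I'} x∈I y∈I' agree z = mk⇔ to′ from′
      where
      to′ : Outside I' (replace C x y y∉C can) z → Outside I C z
      to′ ((i , rᵢ≡z) , z∉I') with rename-spec x y (vertex i)
      ... | inj₁ (_ , rᵢ≡y) = ⊥-elim (z∉I' (subst (_∈ I') (trans (sym rᵢ≡y) rᵢ≡z) y∈I'))
      ... | inj₂ (vᵢ≢x , rᵢ≡vᵢ) = (i , vᵢ≡z) ,
            λ z∈I → z∉I' (from (agree z (λ { refl → vᵢ≢x vᵢ≡z }) (λ { refl → y∉C (i , vᵢ≡z) })) z∈I)
        where vᵢ≡z = trans (sym rᵢ≡vᵢ) rᵢ≡z
      from′ : Outside I C z → Outside I' (replace C x y y∉C can) z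
      from′ ((i , vᵢ≡z) , z∉I) with rename-spec x y (vertex i)
      ... | inj₁ (vᵢ≡x , _) = ⊥-elim (z∉I (subst (_∈ I) (trans (sym vᵢ≡x) vᵢ≡z) x∈I))
      ... | inj₂ (vᵢ≢x , rᵢ≡vᵢ) = (i , trans rᵢ≡vᵢ vᵢ≡z) ,
            λ z∈I' → z∉I (to (agree z (λ { refl → vᵢ≢x vᵢ≡z }) (λ { refl → y∉C (i , vᵢ≡z) })) z∈I')

  Outside-cong : ∀ {I I' C} → (∀ i → Cycle.vertex C i ∈ I' ⇔ Cycle.vertex C i ∈ I) →
                 ∀ z → Outside I' C z ⇔ Outside I C z
  Outside-cong agree z = mk⇔
    (λ { ((i , refl) , z∉I') → (i , refl) , z∉I' ∘ from (agree i) })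
    (λ { ((i , refl) , z∉I) → (i , refl) , z∉I ∘ to (agree i) })

  Resolvable-transfer : ∀ {I I' C C'} → (∀ z → Outside I' C' z ⇔ Outside I C z) →
                        TSReach G I I' → Resolvable G I C → Resolvable G I' C'
  Resolvable-transfer out⇔ I↝I' res B B-part
    with res B (λ v → to (out⇔ v) ∘ proj₁ (B-part v) ,
                      curry (uncurry (proj₂ (B-part v)) ∘ from (out⇔ v)))
  ... | K , indK , I↝K , acyclic = K , indK , TSReach-sym G I↝I' ◅◅ I↝K , acyclic

module Reconfiguration {n : ℕ} (G : Graph n) (connected : Connected G) (claw-free : ClawFree G)
  where

  Δ : Subset n → Subset n → Subset n
  Δ = _Δ_ G

  -- Either x has a unique X-neighbour, which slides onto x, or x is free and any token of
  -- X ∖ Y walks to x.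
  reach-[↦] : ∀ {X Y x} → Independent G X → Independent G Y → ∣ X ∣ ≡ ∣ Y ∣ → x ∈ Y → x ∉ X →
              ¬ TwoNeighbours G X x → ∃ λ a → a ∈ X × a ∉ Y × TSReach G X (X [ a ↦ x ])
  reach-[↦] {X} {Y} {x} indX indY size x∈Y x∉X ¬two with any? (λ y → (y ∈? X) ×-dec E? G x y)
  ... | yes (y , y∈X , xy) =
    y , y∈X , (λ y∈Y → indY x y x∈Y y∈Y xy) , slide-move G indX y∈X x∉X (E-sym G xy) only-y ◅ ε
    where
    only-y : ∀ z → z ∈ X → E G x z → z ≡ y
    only-y z z∈X xz with z Fin.≟ y
    ... | yes z≡y = z≡y
    ... | no z≢y = ⊥-elim (¬two (y , z , z≢y ∘ sym , y∈X , z∈X , xy , xz))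
  ... | no ¬nbr with ∣≡∣⇒Nonempty─ size (x , x∈p∧x∉q⇒x∈p─q x∈Y x∉X)
  ...   | a , a∈X─Y with x∈p─q⁻ a∈X─Y
  ...     | a∈X , a∉Y = a , a∈X , a∉Y ,
    slide-along G claw-free indX a∈X (x∉X , λ z z∈X xz → ¬nbr (z , z∈X , xz)) (connected a x)

  AllResolvable : Subset n → Subset n → Set
  AllResolvable I J = ∀ C → CycleIn G (Δ I J) C → Resolvable G I C

  AllResolvable-transfer : ∀ {I J I' J'} → TSReach G I I' →
                           (∀ {x} → x ∈ Δ I' J' → x ∈ Δ I J × (x ∈ I' ⇔ x ∈ I)) →
                           AllResolvable I J → AllResolvable I' J'
  AllResolvable-transfer I↝I' agree res C C⊆Δ' =
    Resolvable-transfer G {C = C} {C' = C} (Outside-cong G {C = C} λ i → proj₂ (agree (C⊆Δ' i)))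
      I↝I' (res C λ i → proj₁ (agree (C⊆Δ' i)))

  record Config (I J : Subset n) : Set where
    field
      independent-I : Independent G I
      independent-J : Independent G J
      same-size : ∣ I ∣ ≡ ∣ J ∣
      resolvable : AllResolvable I J

  open Config

  gap : Subset n → Subset n → ℕ
  gap I J = ∣ J ─ I ∣

  record Closer (I J : Subset n) : Set where
    field
      {I' J'} : Subset n
      I↝I' : TSReach G I I'
      J↝J' : TSReach G J J'
      gap< : gap I' J' < gap I J
      config : Config I' J'

  Closer-after : ∀ {I J I₁ J₁} → TSReach G I I₁ → TSReach G J J₁ → gap I₁ J₁ ≤ gap I J →
                 Closer I₁ J₁ → Closer I J
  Closer-after I↝I₁ J↝J₁ gap≤ closer = record
    { I↝I' = I↝I₁ ◅◅ I↝I' ; J↝J' = J↝J₁ ◅◅ J↝J' ; gap< = ℕₚ.<-≤-trans gap< gap≤ ; config = config }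
    where open Closer closer

  closer-by-I : ∀ {I J b} → Config I J → b ∈ J → b ∉ I → ¬ TwoNeighbours G I b → Closer I J
  closer-by-I {I} {J} {b} cfg b∈J b∉I ¬two
    with reach-[↦] (independent-I cfg) (independent-J cfg) (same-size cfg) b∈J b∉I ¬two
  ... | a , a∈I , a∉J , I↝I' = record
    { I↝I' = I↝I'
    ; J↝J' = ε
    ; gap< = p⊂q⇒∣p∣<∣q∣ (gap⊆ , b , x∈p∧x∉q⇒x∈p─q b∈J b∉I , λ b∈ → proj₂ (x∈p─q⁻ b∈) b∈I')
    ; config = record
      { independent-I = TSReach-independent G (independent-I cfg) I↝I'
      ; independent-J = independent-J cfg
      ; same-size = trans (sym (TSReach-size G I↝I')) (same-size cfg)
      ; resolvable = AllResolvable-transfer I↝I' agree (resolvable cfg)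
      }
    }
    where
    b∈I' : b ∈ I [ a ↦ b ]
    b∈I' = ∈[↦]-new {I = I} {a = a}
    gap⊆ : J ─ I [ a ↦ b ] ⊆ J ─ I
    gap⊆ z∈ with x∈p─q⁻ z∈
    ... | z∈J , z∉I' = x∈p∧x∉q⇒x∈p─q z∈J (λ z∈I → z∉I' (∈[↦]-kept z∈I λ { refl → a∉J z∈J }))
    agree : ∀ {x} → x ∈ Δ (I [ a ↦ b ]) J → x ∈ Δ I J × (x ∈ I [ a ↦ b ] ⇔ x ∈ I)
    agree x∈Δ = ∈Δ-cong G I'⇔I (⇔-id _) x∈Δ , I'⇔I
      where
      I'⇔I = [↦]-agrees (∈Δ⇒≢-neither G x∈Δ (∉[↦]-vacated λ { refl → b∉I a∈I }) a∉J)
                        (∈Δ⇒≢-both G x∈Δ b∈I' b∈J)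

  closer-by-J : ∀ {I J a} → Config I J → a ∈ I → a ∉ J → ¬ TwoNeighbours G J a → Closer I J
  closer-by-J {I} {J} {a} cfg a∈I a∉J ¬two
    with reach-[↦] (independent-J cfg) (independent-I cfg) (sym (same-size cfg)) a∈I a∉J ¬two
  ... | b , b∈J , b∉I , J↝J' = record
    { I↝I' = ε
    ; J↝J' = J↝J'
    ; gap< = p⊂q⇒∣p∣<∣q∣ (gap⊆ , b , x∈p∧x∉q⇒x∈p─q b∈J b∉I ,
                          λ b∈ → ∉[↦]-vacated b≢a (proj₁ (x∈p─q⁻ b∈)))
    ; config = record
      { independent-I = independent-I cfg
      ; independent-J = TSReach-independent G (independent-J cfg) J↝J'
      ; same-size = trans (same-size cfg) (TSReach-size G J↝J')
      ; resolvable = AllResolvable-transfer ε agree (resolvable cfg)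
      }
    }
    where
    b≢a : b ≢ a
    b≢a refl = b∉I a∈I
    a∈J' : a ∈ J [ b ↦ a ]
    a∈J' = ∈[↦]-new {I = J} {a = b}
    gap⊆ : J [ b ↦ a ] ─ I ⊆ J ─ I
    gap⊆ z∈ with x∈p─q⁻ z∈
    ... | z∈J' , z∉I = x∈p∧x∉q⇒x∈p─q (∈[↦]-old z∈J' λ { refl → z∉I a∈I }) z∉I
    agree : ∀ {x} → x ∈ Δ I (J [ b ↦ a ]) → x ∈ Δ I J × (x ∈ I ⇔ x ∈ I)
    agree x∈Δ = ∈Δ-cong G (⇔-id _) J'⇔J x∈Δ , ⇔-id _
      where
      J'⇔J = [↦]-agrees (∈Δ⇒≢-neither G x∈Δ b∉I (∉[↦]-vacated b≢a))
                        (∈Δ⇒≢-both G x∈Δ a∈I a∈J')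

  Surrounded : Subset n → Subset n → Set
  Surrounded I J = ∀ b → b ∈ J → b ∉ I → TwoNeighbours G I b

  record Trapped (I J B : Subset n) : Set where
    field
      cycle : Cycle G
      in-Δ : CycleIn G (Δ I J) cycle
      outside⊆B : ∀ z → Outside G I cycle z → z ∈ B

  open Trapped

  Trapped⇒CycleIn∪ : ∀ {I J B} (t : Trapped I J B) → CycleIn G (I ∪ B) (cycle t)
  Trapped⇒CycleIn∪ {I} t i with Cycle.vertex (cycle t) i ∈? I
  ... | yes vᵢ∈I = x∈p∪q⁺ (inj₁ vᵢ∈I)
  ... | no vᵢ∉I = x∈p∪q⁺ (inj₂ (outside⊆B t _ ((i , refl) , vᵢ∉I)))

  module Move {I J u v} (cfg : Config I J) (surrounded : Surrounded I J)
              (u∈I : u ∈ I) (v∉I : v ∉ I) (uv : E G u v) (I-move : TSMove G I (I [ u ↦ v ])) where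

    ind' : Independent G (I [ u ↦ v ])
    ind' = proj₁ (proj₂ I-move)

    v∈I' : v ∈ I [ u ↦ v ]
    v∈I' = ∈[↦]-new {I = I} {a = u}

    u∉I' : u ∉ I [ u ↦ v ]
    u∉I' = ∉[↦]-vacated (E⇒≢ G uv)

    ∈I⇒≢v : ∀ {z} → z ∈ I → z ≢ v
    ∈I⇒≢v z∈I refl = v∉I z∈I

    I-neighbour-of-v : ∀ {z} → z ∈ I → E G v z → z ≡ u
    I-neighbour-of-v {z} z∈I vz with z Fin.≟ u
    ... | yes z≡u = z≡u
    ... | no z≢u = ⊥-elim (ind' v z v∈I' (∈[↦]-kept z∈I z≢u) vz)

    -- Otherwise w would be the centre of a claw on v and its two I-neighbours.
    J∖I-neighbour-of-v : ∀ {w} → w ∈ J → w ∉ I → E G v w → E G w u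
    J∖I-neighbour-of-v {w} w∈J w∉I vw with E? G w u | surrounded w w∈J w∉I
    ... | yes wu | _ = wu
    ... | no ¬wu | x , y , x≢y , x∈I , y∈I , wx , wy =
      ⊥-elim (claw-free w x y v wx wy (E-sym G vw) x≢y (∈I⇒≢v x∈I) (∈I⇒≢v y∈I)
                (independent-I cfg x y x∈I y∈I) (non-adjacent-v x∈I wx) (non-adjacent-v y∈I wy))
      where
      non-adjacent-v : ∀ {z} → z ∈ I → E G w z → ¬ E G z v
      non-adjacent-v {z} z∈I wz zv =
        ind' z v (∈[↦]-kept z∈I λ { refl → ¬wu wz }) v∈I' zv

    v∉J : v ∉ J
    v∉J v∈J with surrounded v v∈J v∉I
    ... | x , y , x≢y , x∈I , y∈I , vx , vy =
      x≢y (trans (I-neighbour-of-v x∈I vx) (sym (I-neighbour-of-v y∈I vy)))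

    size' : ∣ I [ u ↦ v ] ∣ ≡ ∣ J ∣
    size' = trans (∣[↦]∣ u∈I v∉I) (same-size cfg)

    module Parallel (u∈J : u ∈ J) where

      J-move : TSMove G J (J [ u ↦ v ])
      J-move = slide-move G (independent-J cfg) u∈J v∉J uv only-u
        where
        only-u : ∀ w → w ∈ J → E G v w → w ≡ u
        only-u w w∈J vw with w ∈? I
        ... | yes w∈I = I-neighbour-of-v w∈I vw
        ... | no w∉I = ⊥-elim (independent-J cfg w u w∈J u∈J (J∖I-neighbour-of-v w∈J w∉I vw))

      agree : ∀ {x} → x ≢ u → x ≢ v →
              (x ∈ I [ u ↦ v ] ⇔ x ∈ I) × (x ∈ J [ u ↦ v ] ⇔ x ∈ J)
      agree x≢u x≢v = [↦]-agrees x≢u x≢v , [↦]-agrees x≢u x≢v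

      ∈Δ⇒≢u,v : ∀ {x} → x ∈ Δ I J → x ≢ u × x ≢ v
      ∈Δ⇒≢u,v x∈Δ = ∈Δ⇒≢-both G x∈Δ u∈I u∈J , ∈Δ⇒≢-neither G x∈Δ v∉I v∉J

      ∈Δ'⇒∈Δ : ∀ {x} → x ∈ Δ (I [ u ↦ v ]) (J [ u ↦ v ]) → x ∈ Δ I J
      ∈Δ'⇒∈Δ x∈Δ' with agree (∈Δ⇒≢-neither G x∈Δ' u∉I' (∉[↦]-vacated (E⇒≢ G uv)))
                             (∈Δ⇒≢-both G x∈Δ' v∈I' (∈[↦]-new {I = J} {a = u}))
      ... | I'⇔I , J'⇔J = ∈Δ-cong G I'⇔I J'⇔J x∈Δ'

      ∈Δ⇒∈Δ' : ∀ {x} → x ∈ Δ I J → x ∈ Δ (I [ u ↦ v ]) (J [ u ↦ v ])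
      ∈Δ⇒∈Δ' x∈Δ with agree (proj₁ (∈Δ⇒≢u,v x∈Δ)) (proj₂ (∈Δ⇒≢u,v x∈Δ))
      ... | I'⇔I , J'⇔J = ∈Δ-cong G (⇔-sym I'⇔I) (⇔-sym J'⇔J) x∈Δ

      config' : Config (I [ u ↦ v ]) (J [ u ↦ v ])
      config' = record
        { independent-I = ind'
        ; independent-J = proj₁ (proj₂ J-move)
        ; same-size = trans size' (sym (∣[↦]∣ u∈J v∉J))
        ; resolvable = AllResolvable-transfer (I-move ◅ ε)
            (λ x∈Δ' → ∈Δ'⇒∈Δ x∈Δ' , proj₁ (uncurry agree (∈Δ⇒≢u,v (∈Δ'⇒∈Δ x∈Δ'))))
            (resolvable cfg)
        }

      gap≤ : gap (I [ u ↦ v ]) (J [ u ↦ v ]) ≤ gap I J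
      gap≤ = ℕₚ.≤-reflexive (cong ∣_∣ ([↦]─[↦] u∈I v∉J))

      trapped' : ∀ {B} → Trapped I J B → Trapped (I [ u ↦ v ]) (J [ u ↦ v ]) B
      trapped' t = record
        { cycle = cycle t
        ; in-Δ = ∈Δ⇒∈Δ' ∘ in-Δ t
        ; outside⊆B = λ z → outside⊆B t z ∘ to (Outside-cong G {C = cycle t} agree-on-cycle z)
        }
        where
        agree-on-cycle = λ i → proj₁ (uncurry agree (∈Δ⇒≢u,v (in-Δ t i)))

    module Sequential (u∉J : u ∉ J) where

      gap≤ : gap (I [ u ↦ v ]) J ≤ gap I J
      gap≤ = p⊆q⇒∣p∣≤∣q∣ gap⊆
        where
        gap⊆ : J ─ I [ u ↦ v ] ⊆ J ─ I
        gap⊆ z∈ with x∈p─q⁻ z∈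
        ... | z∈J , z∉I' = x∈p∧x∉q⇒x∈p─q z∈J (λ z∈I → z∉I' (∈[↦]-kept z∈I λ { refl → u∉J z∈J }))

      -- A cycle through v is resolvable once v is replaced by u: every vertex of the cycle
      -- adjacent to v lies in J ∖ I and is therefore adjacent to u.
      resolvable' : AllResolvable (I [ u ↦ v ]) J
      resolvable' D D⊆Δ' with onCycle? G D v
      ... | no v∉D = Resolvable-transfer G {C = D} {C' = D} (Outside-cong G {C = D} agree)
                       (I-move ◅ ε) (resolvable cfg D λ i → ∈Δ-cong G (agree i) (⇔-id _) (D⊆Δ' i))
        where
        agree : ∀ i → Cycle.vertex D i ∈ I [ u ↦ v ] ⇔ Cycle.vertex D i ∈ I
        agree i = [↦]-agrees (∈Δ⇒≢-neither G (D⊆Δ' i) u∉I' u∉J) λ Dᵢ≡v → v∉D (i , Dᵢ≡v)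
      ... | yes _ = Resolvable-transfer G {C = D°} {C' = D}
                      (λ z → ⇔-sym (Outside-replace G {C = D} {y∉C = u∉D} {can} v∈I' u∈I agree z))
                      (I-move ◅ ε) (resolvable cfg D° D°⊆Δ)
        where
        open Cycle D
        u∉D : ¬ OnCycle G D u
        u∉D (i , Dᵢ≡u) = ∈Δ⇒≢-neither G (D⊆Δ' i) u∉I' u∉J Dᵢ≡u
        can : CanReplace G D v u
        can i vDᵢ = E-sym G (J∖I-neighbour-of-v Dᵢ∈J Dᵢ∉I vDᵢ)
          where
          Dᵢ∈J : vertex i ∈ J
          Dᵢ∈J = ∈Δ∧∉⇒∈ G (D⊆Δ' i) λ Dᵢ∈I' → ind' v (vertex i) v∈I' Dᵢ∈I' vDᵢ
          Dᵢ∉I : vertex i ∉ I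
          Dᵢ∉I Dᵢ∈I = u∉D (i , I-neighbour-of-v Dᵢ∈I vDᵢ)
        D° : Cycle G
        D° = replace G D v u u∉D can
        agree : ∀ z → z ≢ v → z ≢ u → z ∈ I ⇔ z ∈ I [ u ↦ v ]
        agree z z≢v z≢u = ⇔-sym ([↦]-agrees z≢u z≢v)
        D°⊆Δ : CycleIn G (Δ I J) D°
        D°⊆Δ = CycleIn-replace G {C = D} {y∉C = u∉D} {can}
          (λ i Dᵢ≢v → ∈Δ-cong G (⇔-sym (agree _ Dᵢ≢v λ Dᵢ≡u → u∉D (i , Dᵢ≡u))) (⇔-id _) (D⊆Δ' i))
          (∈Δ⁺ˡ G u∈I u∉J)

      config' : Config (I [ u ↦ v ]) J
      config' = record
        { independent-I = ind'
        ; independent-J = independent-J cfg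
        ; same-size = size'
        ; resolvable = resolvable'
        }

      trapped' : ∀ {B} (t : Trapped I J B) → CanReplace G (cycle t) u v → Trapped (I [ u ↦ v ]) J B
      trapped' t can = record
        { cycle = replace G (cycle t) u v v∉C can
        ; in-Δ = CycleIn-replace G {C = cycle t} {y∉C = v∉C} {can}
            (λ i Cᵢ≢u → ∈Δ-cong G (⇔-sym ([↦]-agrees Cᵢ≢u λ Cᵢ≡v → v∉C (i , Cᵢ≡v))) (⇔-id _)
                                   (in-Δ t i))
            (∈Δ⁺ˡ G v∈I' v∉J)
        ; outside⊆B = λ z → outside⊆B t z ∘
            to (Outside-replace G {C = cycle t} {y∉C = v∉C} {can} u∈I v∈I' (λ _ → [↦]-agrees) z)
        }
        where
        v∉C : ¬ OnCycle G (cycle t) v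
        v∉C (i , Cᵢ≡v) = ∈Δ⇒≢-neither G (in-Δ t i) v∉I v∉J Cᵢ≡v

      -- Otherwise w would be the centre of a claw on u and two neighbours in I [ u ↦ v ].
      closer' : ∀ {w} → w ∈ Δ I J → E G u w → ¬ E G v w → Closer (I [ u ↦ v ]) J
      closer' {w} w∈Δ uw ¬vw = closer-by-I config' (∈Δ∧∉⇒∈ G w∈Δ w∉I) w∉I' ¬two
        where
        w∉I : w ∉ I
        w∉I w∈I = independent-I cfg u w u∈I w∈I uw
        w∉I' : w ∉ I [ u ↦ v ]
        w∉I' = ∉[↦]-other w∉I (∈Δ⇒≢-neither G w∈Δ v∉I v∉J)
        in-I : ∀ {z} → z ∈ I [ u ↦ v ] → E G w z → z ∈ I
        in-I z∈ wz = ∈[↦]-old z∈ λ { refl → ¬vw (E-sym G wz) }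
        ¬two : ¬ TwoNeighbours G (I [ u ↦ v ]) w
        ¬two (x , y , x≢y , x∈ , y∈ , wx , wy) =
          claw-free w u x y (E-sym G uw) wx wy (λ { refl → u∉I' x∈ }) (λ { refl → u∉I' y∈ }) x≢y
            (ind u x u∈I (in-I x∈ wx)) (ind u y u∈I (in-I y∈ wy))
            (ind x y (in-I x∈ wx) (in-I y∈ wy))
          where ind = independent-I cfg

  lonely⊎Surrounded : ∀ X Y → (∃ λ b → b ∈ Y × b ∉ X × ¬ TwoNeighbours G X b) ⊎ Surrounded X Y
  lonely⊎Surrounded X Y with any? (λ b → (b ∈? Y) ×-dec ¬? (b ∈? X) ×-dec ¬? (twoNeighbours? G X b))
  ... | yes lonely = inj₁ lonely
  ... | no ¬lonely = inj₂ λ b b∈Y b∉X →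
    decidable-stable (twoNeighbours? G X b) λ ¬two → ¬lonely (b , b∈Y , b∉X , ¬two)

  Surrounded⇒min-degree₂ : ∀ {I J} → Independent G I → Independent G J →
                           Surrounded I J → Surrounded J I →
                           ∀ x → x ∈ Δ I J → TwoNeighbours G (Δ I J) x
  Surrounded⇒min-degree₂ indI indJ surroundedᴵ surroundedᴶ x x∈Δ with ∈Δ⁻ G x∈Δ
  ... | inj₁ (x∈I , x∉J) = TwoNeighbours-mono G
    (λ xy y∈J → ∈Δ⁺ʳ G y∈J λ y∈I → indI x _ x∈I y∈I xy) (surroundedᴶ x x∈I x∉J)
  ... | inj₂ (x∈J , x∉I) = TwoNeighbours-mono G
    (λ xy y∈I → ∈Δ⁺ˡ G y∈I λ y∈J → indJ x _ x∈J y∈J xy) (surroundedᴵ x x∈J x∉I)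

  -- G[K ∪ B] is acyclic, so somewhere along I ⇝ K the trapped cycle breaks. Each move u → v
  -- is either mirrored in J, or carries the cycle along with u replaced by v, or leaves a
  -- vertex of J ∖ I with fewer than two neighbours in the new set.
  progress : ∀ {I J K B} → Config I J → Trapped I J B → TSReach G I K → Acyclic G (K ∪ B) →
             Closer I J
  progress cfg t ε acyclic = ⊥-elim (acyclic (cycle t) (Trapped⇒CycleIn∪ t))
  progress {I} {J} cfg t (I-move ◅ rest) acyclic with lonely⊎Surrounded I J
  ... | inj₁ (b , b∈J , b∉I , ¬two) = closer-by-I cfg b∈J b∉I ¬two
  ... | inj₂ surrounded with TSMove⇒[↦] G I-move
  ...   | u , v , u∈I , v∉I , uv , refl with u ∈? J
  ...     | yes u∈J =
    Closer-after (I-move ◅ ε) (J-move ◅ ε) gap≤ (progress config' (trapped' t) rest acyclic)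
    where open Move cfg surrounded u∈I v∉I uv I-move
          open Parallel u∈J
  ...     | no u∉J with canReplace? G (cycle t) u v
  ...       | inj₁ can =
    Closer-after (I-move ◅ ε) ε gap≤ (progress config' (trapped' t can) rest acyclic)
    where open Move cfg surrounded u∈I v∉I uv I-move
          open Sequential u∉J
  ...       | inj₂ (i , uw , ¬vw) = Closer-after (I-move ◅ ε) ε gap≤ (closer' (in-Δ t i) uw ¬vw)
    where open Move cfg surrounded u∈I v∉I uv I-move
          open Sequential u∉J

  trap : ∀ {I J} (C : Cycle G) → CycleIn G (Δ I J) C → Resolvable G I C →
         ∃₂ λ K B → TSReach G I K × Acyclic G (K ∪ B) × Trapped I J B
  trap {I} C C⊆Δ res
    with res ⟦ outside? G I C ⟧ (λ z → ∈⟦⟧⁻ (outside? G I C) , curry (∈⟦⟧⁺ (outside? G I C)))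
  ... | K , _ , I↝K , acyclic = K , _ , I↝K , acyclic ,
    record { cycle = C ; in-Δ = C⊆Δ ; outside⊆B = λ z → ∈⟦⟧⁺ (outside? G I C) }

  closer : ∀ {I J b} → Config I J → b ∈ J → b ∉ I → Closer I J
  closer {I} {J} {b} cfg b∈J b∉I with lonely⊎Surrounded I J | lonely⊎Surrounded J I
  ... | inj₁ (b' , b'∈J , b'∉I , ¬two) | _ = closer-by-I cfg b'∈J b'∉I ¬two
  ... | inj₂ _ | inj₁ (a , a∈I , a∉J , ¬two) = closer-by-J cfg a∈I a∉J ¬two
  ... | inj₂ surroundedᴵ | inj₂ surroundedᴶ
    with cycle-within G (Surrounded⇒min-degree₂ (independent-I cfg) (independent-J cfg)
                                                 surroundedᴵ surroundedᴶ)
                        (∈Δ⁺ʳ G b∈J b∉I)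
  ...   | C , C⊆Δ with trap C C⊆Δ (resolvable cfg C C⊆Δ)
  ...     | _ , _ , I↝K , acyclic , t = progress cfg t I↝K acyclic

  reconfigure : ∀ k {I J} → gap I J < k → Config I J → TSReach G I J
  reconfigure (suc k) {I} {J} gap<k cfg with ⊆⊎Nonempty─ J I
  ... | inj₁ J⊆I = subst (TSReach G I) (∣≡∣∧⊆⇒≡ (same-size cfg) J⊆I) ε
  ... | inj₂ (b , b∈J─I) =
    I↝I' ◅◅ reconfigure k (ℕₚ.<-≤-trans gap< (ℕ.s≤s⁻¹ gap<k)) config ◅◅ TSReach-sym G J↝J'
    where open Closer (closer cfg (proj₁ (x∈p─q⁻ b∈J─I)) (proj₂ (x∈p─q⁻ b∈J─I)))

-- J itself witnesses resolvability: the part B of a cycle of G[I Δ J] lies in J.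
reachable⇒resolvable : ∀ {n} (G : Graph n) {I J} → Independent G J → TSReach G I J →
                       ∀ C → CycleIn G (_Δ_ G I J) C → Resolvable G I C
reachable⇒resolvable G {I} {J} indJ I↝J C C⊆Δ B B-part = J , indJ , I↝J , acyclic
  where
  J∪B⊆J : J ∪ B ⊆ J
  J∪B⊆J {x} x∈ with x∈p∪q⁻ J B x∈
  ... | inj₁ x∈J = x∈J
  ... | inj₂ x∈B with proj₁ (B-part x) x∈B
  ...   | (i , refl) , x∉I = ∈Δ∧∉⇒∈ G (C⊆Δ i) x∉I
  acyclic : Acyclic G (J ∪ B)
  acyclic D D⊆ = indJ _ _ (J∪B⊆J (D⊆ zero)) (J∪B⊆J (D⊆ (next zero))) (Cycle.edges D zero)

theorem10 : ∀ {n : ℕ} (G : Graph n) → Connected G → ClawFree G →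
    (I J : Subset n) → Independent G I → Independent G J → ∣ I ∣ ≡ ∣ J ∣ →
    (TSReach G I J → (∀ (C : Cycle G) → CycleIn G (_Δ_ G I J) C → Resolvable G I C))
    × ((∀ (C : Cycle G) → CycleIn G (_Δ_ G I J) C → Resolvable G I C) → TSReach G I J)
theorem10 G connected claw-free I J indI indJ same-size =
  reachable⇒resolvable G indJ ,
  λ resolvable → reconfigure (suc (gap I J)) (ℕₚ.n<1+n _) record
    { independent-I = indI
    ; independent-J = indJ
    ; same-size = same-size
    ; resolvable = resolvable
    }
  where open Reconfiguration G connected claw-free
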